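{- For all integers $n, \ell\ge 3$ the shift hypergraph $\mathrm{Sh}^{(3)}(n, \ell)$ does not contain $K_4^{(3)- }$ as a subhypergraph.
   Context: For integers $n,\ell\ge k\ge 2$, the $k$-uniform shift hypergraph $\mathrm{Sh}^{(k)}(n,\ell)$ has vertex set $[n]^{(\ell)}$, the family of all $\ell$-element subsets of $[n]=\{1,\dots,n\}$, and its edges are obtained as follows: for every increasing sequence $a_1<\dots<a_{k+\ell-1}$ of integers from $[n]$ the set $\{x_1,\dots,x_k\}$ with $x_i=\{a_i,\dots,a_{i+\ell-1}\}$ ($i\in[k]$) is an edge. $K_4^{(3)- }$ denotes the $3$-uniform hypergraph with four vertices and three edges. -}

module Defs where

open import Data.Nat using (ℕ; suc; _+_)
open import Data.Fin using (Fin; suc; inject₁; _<_; _≟_)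
open import Data.Fin.Subset using (Subset; ∣_∣)
open import Data.Fin.Properties using (any?)
open import Data.Vec using (tabulate)
open import Data.Product using (∃; _×_; Σ; _,_; proj₁)
open import Data.Sum using (_⊎_)
open import Relation.Nullary using (¬_; does)
open import Relation.Binary.PropositionalEquality using (_≡_; _≢_)

Vertex : ℕ → ℕ → Set
Vertex n ℓ = Σ (Subset n) λ x → ∣ x ∣ ≡ ℓ

StrictlyIncreasing : ∀ {m n} → (Fin m → Fin n) → Set
StrictlyIncreasing a = ∀ i j → i < j → a i < a j

window : ∀ {n ℓ} → (Fin (2 + ℓ) → Fin n) → (Fin ℓ → Fin (2 + ℓ)) → Subset n
window {ℓ = ℓ} a f = tabulate λ j → does (any? λ (t : Fin ℓ) → a (f t) ≟ j)

-- x₁ = {a₁,…,a_ℓ}, x₂ = {a₂,…,a_{ℓ+1}}, x₃ = {a₃,…,a_{ℓ+2}}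
x₁ x₂ x₃ : ∀ {n ℓ} → (Fin (2 + ℓ) → Fin n) → Subset n
x₁ a = window a (λ t → inject₁ (inject₁ t))
x₂ a = window a (λ t → suc (inject₁ t))
x₃ a = window a (λ t → suc (suc t))

IsOneOf : ∀ {n} → Subset n → Subset n → Subset n → Subset n → Set
IsOneOf u p q r = u ≡ p ⊎ u ≡ q ⊎ u ≡ r

IsShEdge3 : (n ℓ : ℕ) → Vertex n ℓ → Vertex n ℓ → Vertex n ℓ → Set
IsShEdge3 n ℓ (u , _) (v , _) (w , _) =
  u ≢ v × u ≢ w × v ≢ w ×
  ∃ λ (a : Fin (2 + ℓ) → Fin n) → StrictlyIncreasing a ×
    IsOneOf u (x₁ a) (x₂ a) (x₃ a) × IsOneOf v (x₁ a) (x₂ a) (x₃ a) ×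
    IsOneOf w (x₁ a) (x₂ a) (x₃ a)

-- Any three of the four triples on four vertices form a copy of K₄^(3)-,
-- so we may fix the triples {v₁v₂v₃}, {v₁v₂v₄}, {v₁v₃v₄}.
ContainsK4Minus : ℕ → ℕ → Set
ContainsK4Minus n ℓ =
  ∃ λ (v₁ : Vertex n ℓ) → ∃ λ v₂ → ∃ λ v₃ → ∃ λ v₄ →
    proj₁ v₁ ≢ proj₁ v₄ ×
    proj₁ v₂ ≢ proj₁ v₄ ×
    proj₁ v₃ ≢ proj₁ v₄ ×
    IsShEdge3 n ℓ v₁ v₂ v₃ × IsShEdge3 n ℓ v₁ v₂ v₄ × IsShEdge3 n ℓ v₁ v₃ v₄

-- Label each vertex x of Sh⁽³⁾(n, ℓ) by its least element f x and its second least element s x.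
-- The edge {x₁, x₂, x₃} coming from a₁ < ⋯ < a_{ℓ+2} is a chain: f xᵢ = aᵢ and s xᵢ = aᵢ₊₁, so
-- f x₁ < f x₂ < f x₃, s x₁ = f x₂ and s x₂ = f x₃. Hence an edge is determined (in f) by its least
-- vertex: two edges sharing their least vertex and one more vertex agree in f on the remaining one.
-- In a copy of K₄⁽³⁾⁻ the vertex with least f lies in two of the three edges, which share a
-- second vertex; their remaining vertices then have equal f, although they lie in a common edge.
module Submission where

open import Defs
open import Data.Nat using (ℕ; _+_; zero; suc; s≤s; _≤_; _<_; _≥_; z<s; s<s)
open import Data.Nat.Properties using (<-irrefl; <-asym; <-trans; <⇒≢; <⇒≱)
open import Data.Bool using (true; false)
open import Data.Fin using (Fin; zero; suc; toℕ; inject₁; _≟_) renaming (_<_ to _<ᶠ_)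
open import Data.Fin.Subset using (Subset)
open import Data.Fin.Properties using (any?; toℕ-inject₁; suc-injective)
open import Data.Vec using ([]; _∷_; lookup; tabulate)
open import Data.Vec.Properties using (lookup∘tabulate)
open import Data.List using (List; []; _∷_)
open import Data.List.Relation.Unary.All using (All; _∷_; [])
open import Data.List.Extrema.Nat using (argmin-all; f[argmin]≤f[⊤]; f[argmin]≤f[xs])
open import Data.Product using (_,_; proj₁)
open import Data.Sum using (_⊎_; inj₁; inj₂)
open import Data.Empty using (⊥; ⊥-elim)
open import Function using (_∘_)
open import Relation.Nullary using (¬_; does)
open import Relation.Nullary.Decidable using (dec-true; dec-false)
open import Relation.Binary.PropositionalEquality using (_≡_; _≢_; refl; sym; trans; cong; subst₂)

module LabelledEdges {V : Set} (f s : V → ℕ) where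

  record Chain (x y z : V) : Set where
    constructor chain
    field
      f₁<f₂ : f x < f y
      f₂<f₃ : f y < f z
      s₁≡f₂ : s x ≡ f y
      s₂≡f₃ : s y ≡ f z

  data IsEdge (u v w : V) : Set where
    uvw : Chain u v w → IsEdge u v w
    uwv : Chain u w v → IsEdge u v w
    vuw : Chain v u w → IsEdge u v w
    vwu : Chain v w u → IsEdge u v w
    wuv : Chain w u v → IsEdge u v w
    wvu : Chain w v u → IsEdge u v w

  swap : ∀ {u v w} → IsEdge u v w → IsEdge v u w
  swap (uvw c) = vuw c
  swap (uwv c) = vwu c
  swap (vuw c) = uvw c
  swap (vwu c) = uwv c
  swap (wuv c) = wvu c
  swap (wvu c) = wuv c

  rotate : ∀ {u v w} → IsEdge u v w → IsEdge v w u
  rotate (uvw c) = wuv c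
  rotate (uwv c) = wvu c
  rotate (vuw c) = uwv c
  rotate (vwu c) = uvw c
  rotate (wuv c) = vwu c
  rotate (wvu c) = vuw c

  edge-f-distinct : ∀ {u v w} → IsEdge u v w → f u ≢ f v
  edge-f-distinct (uvw (chain fu<fv _ _ _))     = <⇒≢ fu<fv
  edge-f-distinct (uwv (chain fu<fw fw<fv _ _)) = <⇒≢ (<-trans fu<fw fw<fv)
  edge-f-distinct (vuw (chain fv<fu _ _ _))     = <⇒≢ fv<fu ∘ sym
  edge-f-distinct (vwu (chain fv<fw fw<fu _ _)) = <⇒≢ (<-trans fv<fw fw<fu) ∘ sym
  edge-f-distinct (wuv (chain _ fu<fv _ _))     = <⇒≢ fu<fv
  edge-f-distinct (wvu (chain _ fv<fu _ _))     = <⇒≢ fv<fu ∘ sym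

  edge-from-least : ∀ {u v w} → f u ≤ f v → f u ≤ f w →
                    IsEdge u v w → Chain u v w ⊎ Chain u w v
  edge-from-least _     _     (uvw c)                       = inj₁ c
  edge-from-least _     _     (uwv c)                       = inj₂ c
  edge-from-least fu≤fv _     (vuw (chain fv<fu _ _ _))     = ⊥-elim (<⇒≱ fv<fu fu≤fv)
  edge-from-least fu≤fv _     (vwu (chain fv<fw fw<fu _ _)) = ⊥-elim (<⇒≱ (<-trans fv<fw fw<fu) fu≤fv)
  edge-from-least _     fu≤fw (wuv (chain fw<fu _ _ _))     = ⊥-elim (<⇒≱ fw<fu fu≤fw)
  edge-from-least _     fu≤fw (wvu (chain fw<fv fv<fu _ _)) = ⊥-elim (<⇒≱ (<-trans fw<fv fv<fu) fu≤fw)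

  -- Both edges are chains from x: their second vertices have f-value s x, so both are y,
  -- and their third vertices then have f-value s y.
  edges-at-least-vertex : ∀ {x y z w} → f x ≤ f y → f x ≤ f z → f x ≤ f w →
                          IsEdge x y z → IsEdge x y w → f z ≡ f w
  edges-at-least-vertex fx≤fy fx≤fz fx≤fw xyz xyw
    with edge-from-least fx≤fy fx≤fz xyz | edge-from-least fx≤fy fx≤fw xyw
  ... | inj₁ (chain _ _ _ sy≡fz) | inj₁ (chain _ _ _ sy≡fw) = trans (sym sy≡fz) sy≡fw
  ... | inj₁ (chain _ _ sx≡fy _) | inj₂ (chain _ fw<fy sx≡fw _) =
    ⊥-elim (<⇒≢ fw<fy (trans (sym sx≡fw) sx≡fy))
  ... | inj₂ (chain _ fz<fy sx≡fz _) | inj₁ (chain _ _ sx≡fy _) =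
    ⊥-elim (<⇒≢ fz<fy (trans (sym sx≡fz) sx≡fy))
  ... | inj₂ (chain _ _ sx≡fz _) | inj₂ (chain _ _ sx≡fw _) = trans (sym sx≡fz) sx≡fw

  K₄⁻-free : ∀ {v₁ v₂ v₃ v₄} → IsEdge v₁ v₂ v₃ → IsEdge v₁ v₂ v₄ → IsEdge v₁ v₃ v₄ → ⊥
  K₄⁻-free {v₁} {v₂} {v₃} {v₄} e₁₂₃ e₁₂₄ e₁₃₄ =
    argmin-all f {P = λ m → IsLeast m → ⊥} least-v₁ (least-v₂ ∷ least-v₃ ∷ least-v₄ ∷ [])
      (f[argmin]≤f[⊤] {f = f} v₁ others ∷ f[argmin]≤f[xs] {f = f} v₁ others)
    where
    others : List V
    others = v₂ ∷ v₃ ∷ v₄ ∷ []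
    IsLeast : V → Set
    IsLeast m = All (λ x → f m ≤ f x) (v₁ ∷ others)

    least-v₁ : IsLeast v₁ → ⊥
    least-v₁ (_ ∷ m≤₂ ∷ m≤₃ ∷ m≤₄ ∷ []) =
      edge-f-distinct (rotate e₁₃₄) (edges-at-least-vertex m≤₂ m≤₃ m≤₄ e₁₂₃ e₁₂₄)

    least-v₂ : IsLeast v₂ → ⊥
    least-v₂ (m≤₁ ∷ _ ∷ m≤₃ ∷ m≤₄ ∷ []) =
      edge-f-distinct (rotate e₁₃₄) (edges-at-least-vertex m≤₁ m≤₃ m≤₄ (swap e₁₂₃) (swap e₁₂₄))

    least-v₃ : IsLeast v₃ → ⊥
    least-v₃ (m≤₁ ∷ m≤₂ ∷ _ ∷ m≤₄ ∷ []) =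
      edge-f-distinct (rotate e₁₂₄) (edges-at-least-vertex m≤₁ m≤₂ m≤₄ (rotate (rotate e₁₂₃)) (swap e₁₃₄))

    least-v₄ : IsLeast v₄ → ⊥
    least-v₄ (m≤₁ ∷ m≤₂ ∷ m≤₃ ∷ _ ∷ []) =
      edge-f-distinct (rotate e₁₂₃)
        (edges-at-least-vertex m≤₁ m≤₂ m≤₃ (rotate (rotate e₁₂₄)) (rotate (rotate e₁₃₄)))

open LabelledEdges

first second : ∀ {n} → Subset n → ℕ
first []          = 0
first (true ∷ x)  = 0
first (false ∷ x) = suc (first x)

second []          = 0
second (true ∷ x)  = suc (first x)
second (false ∷ x) = suc (second x)

first-≡ : ∀ {n} (x : Subset n) (i : Fin n) → lookup x i ≡ true →
          (∀ j → j <ᶠ i → lookup x j ≡ false) → first x ≡ toℕ i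
first-≡ (true ∷ x)  zero    _   _       = refl
first-≡ (false ∷ x) zero    ()  _
first-≡ (b ∷ x)     (suc i) i∈x earlier with earlier zero z<s
... | refl = cong suc (first-≡ x i i∈x (λ j j<i → earlier (suc j) (s<s j<i)))

second-≡ : ∀ {n} (x : Subset n) (i i′ : Fin n) → i <ᶠ i′ → lookup x i ≡ true → lookup x i′ ≡ true →
           (∀ j → j <ᶠ i′ → j ≢ i → lookup x j ≡ false) → second x ≡ toℕ i′
second-≡ (true ∷ x)  zero    (suc i′) _         _   i′∈x earlier =
  cong suc (first-≡ x i′ i′∈x (λ j j<i′ → earlier (suc j) (s<s j<i′) (λ ())))
second-≡ (false ∷ x) zero    (suc i′) _         ()  _    _
second-≡ (b ∷ x)     (suc i) (suc i′) (s<s i<i′) i∈x i′∈x earlier with earlier zero z<s (λ ())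
... | refl = cong suc (second-≡ x i i′ i<i′ i∈x i′∈x
                         (λ j j<i′ j≢i → earlier (suc j) (s<s j<i′) (j≢i ∘ suc-injective)))

image : ∀ {m n} → (Fin m → Fin n) → Subset n
image {m} g = tabulate λ j → does (any? λ (t : Fin m) → g t ≟ j)

∈-image : ∀ {m n} (g : Fin m → Fin n) t → lookup (image g) (g t) ≡ true
∈-image g t = trans (lookup∘tabulate _ (g t)) (dec-true (any? λ t′ → g t′ ≟ g t) (t , refl))

∉-image : ∀ {m n} (g : Fin m → Fin n) j → (∀ t → g t ≢ j) → lookup (image g) j ≡ false
∉-image g j j∉g = trans (lookup∘tabulate _ j) (dec-false (any? λ t → g t ≟ j) λ (t , gt≡j) → j∉g t gt≡j)

first-image : ∀ {m n} (g : Fin (suc m) → Fin n) → StrictlyIncreasing g → first (image g) ≡ toℕ (g zero)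
first-image g g↑ = first-≡ (image g) (g zero) (∈-image g zero) λ j j<g₀ → ∉-image g j λ
  { zero    refl → <-irrefl refl j<g₀
  ; (suc t) refl → <-asym j<g₀ (g↑ zero (suc t) z<s)
  }

second-image : ∀ {m n} (g : Fin (suc (suc m)) → Fin n) → StrictlyIncreasing g →
               second (image g) ≡ toℕ (g (suc zero))
second-image g g↑ =
  second-≡ (image g) (g zero) (g (suc zero)) (g↑ zero (suc zero) z<s) (∈-image g zero) (∈-image g (suc zero))
    λ j j<g₁ j≢g₀ → ∉-image g j λ
      { zero          refl → j≢g₀ refl
      ; (suc zero)    refl → <-irrefl refl j<g₁
      ; (suc (suc t)) refl → <-asym j<g₁ (g↑ (suc zero) (suc (suc t)) (s<s z<s))
      }

∘-strictlyIncreasing : ∀ {k m n} {a : Fin m → Fin n} {h : Fin k → Fin m} →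
                       StrictlyIncreasing a → StrictlyIncreasing h → StrictlyIncreasing (a ∘ h)
∘-strictlyIncreasing a↑ h↑ i j i<j = a↑ _ _ (h↑ i j i<j)

suc-strictlyIncreasing : ∀ {n} → StrictlyIncreasing (suc {n})
suc-strictlyIncreasing i j = s<s

inject₁-strictlyIncreasing : ∀ {n} → StrictlyIncreasing (inject₁ {n})
inject₁-strictlyIncreasing i j i<j rewrite toℕ-inject₁ i | toℕ-inject₁ j = i<j

-- x₁ a, x₂ a and x₃ a are definitionally the images of the three restrictions of a below.
windows-chain : ∀ {n k} (a : Fin (4 + k) → Fin n) → StrictlyIncreasing a →
                Chain first second (x₁ a) (x₂ a) (x₃ a)
windows-chain a a↑ = chain
  (subst₂ _<_ (sym first-x₁) (sym first-x₂) (a↑ zero (suc zero) z<s))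
  (subst₂ _<_ (sym first-x₂) (sym first-x₃) (a↑ (suc zero) (suc (suc zero)) (s<s z<s)))
  (trans second-x₁ (sym first-x₂))
  (trans second-x₂ (sym first-x₃))
  where
  x₁↑ : StrictlyIncreasing (λ t → a (inject₁ (inject₁ t)))
  x₁↑ = ∘-strictlyIncreasing a↑ (∘-strictlyIncreasing inject₁-strictlyIncreasing inject₁-strictlyIncreasing)
  x₂↑ : StrictlyIncreasing (λ t → a (suc (inject₁ t)))
  x₂↑ = ∘-strictlyIncreasing a↑ (∘-strictlyIncreasing suc-strictlyIncreasing inject₁-strictlyIncreasing)
  x₃↑ : StrictlyIncreasing (λ t → a (suc (suc t)))
  x₃↑ = ∘-strictlyIncreasing a↑ (∘-strictlyIncreasing suc-strictlyIncreasing suc-strictlyIncreasing)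

  first-x₁ : first (x₁ a) ≡ toℕ (a zero)
  first-x₁ = first-image _ x₁↑
  second-x₁ : second (x₁ a) ≡ toℕ (a (suc zero))
  second-x₁ = second-image _ x₁↑
  first-x₂ : first (x₂ a) ≡ toℕ (a (suc zero))
  first-x₂ = first-image _ x₂↑
  second-x₂ : second (x₂ a) ≡ toℕ (a (suc (suc zero)))
  second-x₂ = second-image _ x₂↑
  first-x₃ : first (x₃ a) ≡ toℕ (a (suc (suc zero)))
  first-x₃ = first-image _ x₃↑

oneOf-edge : ∀ {n} {p q r u v w : Subset n} → Chain first second p q r → u ≢ v → u ≢ w → v ≢ w →
             IsOneOf u p q r → IsOneOf v p q r → IsOneOf w p q r → IsEdge first second u v w
oneOf-edge c _ _ _ (inj₁ refl)        (inj₂ (inj₁ refl)) (inj₂ (inj₂ refl)) = uvw c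
oneOf-edge c _ _ _ (inj₁ refl)        (inj₂ (inj₂ refl)) (inj₂ (inj₁ refl)) = uwv c
oneOf-edge c _ _ _ (inj₂ (inj₁ refl)) (inj₁ refl)        (inj₂ (inj₂ refl)) = vuw c
oneOf-edge c _ _ _ (inj₂ (inj₁ refl)) (inj₂ (inj₂ refl)) (inj₁ refl)        = wuv c
oneOf-edge c _ _ _ (inj₂ (inj₂ refl)) (inj₁ refl)        (inj₂ (inj₁ refl)) = vwu c
oneOf-edge c _ _ _ (inj₂ (inj₂ refl)) (inj₂ (inj₁ refl)) (inj₁ refl)        = wvu c
oneOf-edge _ u≢v _ _ (inj₁ refl)        (inj₁ refl)        _ = ⊥-elim (u≢v refl)
oneOf-edge _ u≢v _ _ (inj₂ (inj₁ refl)) (inj₂ (inj₁ refl)) _ = ⊥-elim (u≢v refl)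
oneOf-edge _ u≢v _ _ (inj₂ (inj₂ refl)) (inj₂ (inj₂ refl)) _ = ⊥-elim (u≢v refl)
oneOf-edge _ _ u≢w _ (inj₁ refl)        _ (inj₁ refl)        = ⊥-elim (u≢w refl)
oneOf-edge _ _ u≢w _ (inj₂ (inj₁ refl)) _ (inj₂ (inj₁ refl)) = ⊥-elim (u≢w refl)
oneOf-edge _ _ u≢w _ (inj₂ (inj₂ refl)) _ (inj₂ (inj₂ refl)) = ⊥-elim (u≢w refl)
oneOf-edge _ _ _ v≢w _ (inj₁ refl)        (inj₁ refl)        = ⊥-elim (v≢w refl)
oneOf-edge _ _ _ v≢w _ (inj₂ (inj₁ refl)) (inj₂ (inj₁ refl)) = ⊥-elim (v≢w refl)
oneOf-edge _ _ _ v≢w _ (inj₂ (inj₂ refl)) (inj₂ (inj₂ refl)) = ⊥-elim (v≢w refl)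

shEdge-edge : ∀ {n k} (u v w : Vertex n (2 + k)) → IsShEdge3 n (2 + k) u v w →
              IsEdge first second (proj₁ u) (proj₁ v) (proj₁ w)
shEdge-edge _ _ _ (u≢v , u≢w , v≢w , a , a↑ , u∈x , v∈x , w∈x) =
  oneOf-edge (windows-chain a a↑) u≢v u≢w v≢w u∈x v∈x w∈x

Sh³-K₄⁻-free : ∀ n k → ¬ ContainsK4Minus n (2 + k)
Sh³-K₄⁻-free n k (v₁ , v₂ , v₃ , v₄ , _ , _ , _ , e₁₂₃ , e₁₂₄ , e₁₃₄) =
  K₄⁻-free first second (shEdge-edge v₁ v₂ v₃ e₁₂₃) (shEdge-edge v₁ v₂ v₄ e₁₂₄) (shEdge-edge v₁ v₃ v₄ e₁₃₄)

lemma3p4 : (n ℓ : ℕ) → n ≥ 3 → ℓ ≥ 3 → ¬ ContainsK4Minus n ℓ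
lemma3p4 n (suc (suc k)) _ _ = Sh³-K₄⁻-free n k
lemma3p4 n 0 _ ()
lemma3p4 n 1 _ (s≤s ())
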